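{- Let $G$ be a graph, $e$ an edge of $G$, and $S\subseteq V(G)$ with $\operatorname{th_+^\times}(G)=|S|(1+\operatorname{pt_+}(G;S))$. Then $$\operatorname{th_+^\times}(G_e)\leq\min\{|S|(2+\operatorname{pt_+}(G;S)),\ (|S|+1)(1+\operatorname{pt_+}(G;S))\}=\min\{\operatorname{th_+^\times}(G)+|S|,\ \operatorname{th_+^\times}(G)+\operatorname{pt_+}(G;S)+1\}.$$ This bound is tight.
   Context: All graphs are finite and simple. For an edge $e=xy$ of $G$, $G_e$ denotes the graph obtained by subdividing $e$: delete $e$ and add a new vertex $v_e$ adjacent to $x$ and $y$. PSD color change rule: given a set $B$ of blue vertices (others white), let $W_1,\dots,W_k$ be the vertex sets of the components of $G-B$; if $u\in B$ and $w\in W_i$ is the only white neighbor of $u$ in $G[W_i\cup B]$, then $u$ can force $w$. For $S\subseteq V(G)$, $S^{[0]}=S$ and $S^{[i]}=S^{[i-1]}\cup\{w\notin S^{[i-1]}: w$ can be forced given blue set $S^{[i-1]}\}$. $S$ is a PSD forcing set if $S^{[i]}=V(G)$ for some $i$; $\operatorname{pt_+}(G;S)$ is the least such $i$ ($\infty$ if none). $\operatorname{Z_+}(G)$ is the minimum size of a PSD forcing set, and $\operatorname{th_+^\times}(G)=\min\{|S|(1+\operatorname{pt_+}(G;S)): S\subseteq V(G),|S|\ge\operatorname{Z_+}(G)\}$. -}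

module Defs where

open import Data.Nat using (ℕ; zero; suc; _+_; _*_; _≤_; _⊓_)
open import Data.Bool using (Bool; true; false; _∧_; _∨_; not)
open import Data.Fin using (Fin; zero; suc)
open import Data.Fin.Subset using (Subset; _∈_; _∉_; ∣_∣)
open import Data.Product using (Σ; _×_; ∃)
open import Data.Sum using (_⊎_)
open import Relation.Nullary using (¬_; ⌊_⌋)
open import Relation.Binary.PropositionalEquality using (_≡_)
import Data.Fin as F

Adj : ℕ → Set
Adj n = Fin n → Fin n → Bool

IsSimple : ∀ {n} → Adj n → Set
IsSimple {n} G = (∀ (x y : Fin n) → G x y ≡ G y x) × (∀ (x : Fin n) → G x x ≡ false)

-- Subdivision G_e of the edge e = xy: vertex set Fin (suc n), where the new
-- vertex v_e is 'zero' and the old vertex a is 'suc a'.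
subdivide : ∀ {n} → Adj n → Fin n → Fin n → Adj (suc n)
subdivide G x y zero    zero    = false
subdivide G x y zero    (suc b) = ⌊ b F.≟ x ⌋ ∨ ⌊ b F.≟ y ⌋
subdivide G x y (suc a) zero    = ⌊ a F.≟ x ⌋ ∨ ⌊ a F.≟ y ⌋
subdivide G x y (suc a) (suc b) =
  G a b ∧ not ((⌊ a F.≟ x ⌋ ∧ ⌊ b F.≟ y ⌋) ∨ (⌊ a F.≟ y ⌋ ∧ ⌊ b F.≟ x ⌋))

module _ {n : ℕ} (G : Adj n) where

  -- B is a set of blue vertices (as a predicate); white = not blue.
  -- Reach B w w' : w and w' lie in the same component of G - B (both white).
  data Reach (B : Fin n → Set) (w : Fin n) : Fin n → Set where
    here : ¬ B w → Reach B w w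
    step : ∀ {v z} → Reach B w v → G v z ≡ true → ¬ B z → Reach B w z

  CanForce : (Fin n → Set) → Fin n → Fin n → Set
  CanForce B u w =
    B u × ¬ B w × G u w ≡ true ×
    (∀ w' → ¬ B w' → G u w' ≡ true → Reach B w w' → w' ≡ w)

  Blue : Subset n → ℕ → Fin n → Set
  Blue S zero    v = v ∈ S
  Blue S (suc i) v = Blue S i v ⊎ Σ (Fin n) (λ u → CanForce (Blue S i) u v)

  AllBlue : Subset n → ℕ → Set
  AllBlue S i = ∀ v → Blue S i v

  IsPSDForcing : Subset n → Set
  IsPSDForcing S = ∃ λ i → AllBlue S i

  PT : Subset n → ℕ → Set
  PT S k = AllBlue S k × (∀ j → AllBlue S j → k ≤ j)

  ZPlus : ℕ → Set
  ZPlus z = (Σ (Subset n) λ S → IsPSDForcing S × ∣ S ∣ ≡ z)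
          × (∀ S → IsPSDForcing S → z ≤ ∣ S ∣)

  -- ThX t : th_+^×(G) = t, the minimum of |S|(1 + pt_+(G;S)) over S with
  -- |S| ≥ Z_+(G) (sets with pt_+ = ∞ contribute ∞, hence never the minimum).
  ThX : ℕ → Set
  ThX t = Σ ℕ λ z → ZPlus z ×
          (Σ (Subset n) λ S → Σ ℕ λ k → z ≤ ∣ S ∣ × PT S k × t ≡ ∣ S ∣ * (1 + k)) ×
          (∀ S k → z ≤ ∣ S ∣ → PT S k → t ≤ ∣ S ∣ * (1 + k))

{-# OPTIONS --safe #-}
-- Let S force G in k rounds and let vₑ subdivide e = xy. With vₑ added to S, the
-- forcing process on Gₑ follows that of G round by round: a force along e is taken
-- over by vₑ, and every other force survives because the white components of Gₑ
-- project onto white components of G. Starting from S alone, Gₑ falls at most one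
-- round behind: the first force across e becomes "u forces vₑ, then vₑ forces the
-- other endpoint", after which vₑ is blue and the lag no longer grows; if no force
-- crosses e, an endpoint forces vₑ in one extra round at the end. This gives the costs
-- (|S| + 1)(1 + k) and |S|(2 + k). Since the process stabilises within |V| rounds,
-- forcing is decidable and the minimum defining th₊ˣ(Gₑ) exists. For tightness take
-- G = K₂ + K₁ and S = V(G): both G and Gₑ = P₃ + K₁ have Z₊ = 2 and at most four
-- vertices, so the full vertex set is optimal for each and the costs are 3 and 4.

module Submission where

open import Defs

open import Data.Nat using (ℕ; zero; suc; _+_; _*_; _⊓_; _≤_; _<_; _≤′_; ≤′-refl; ≤′-step; z≤n; s≤s)
open import Data.Nat.Properties
  using ( ≤-refl; ≤-reflexive; ≤-trans; ≤-antisym; ≤-total; ≤-pred; n≤1+n; <-irrefl; ≮⇒≥; ≤⇒≤′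
        ; m<1+n⇒m<n∨m≡n; +-suc; +-identityʳ; +-comm; *-comm; *-identityʳ; *-monoʳ-≤; ⊓-glb; _≤?_ )
  renaming (_≟_ to _≟ℕ_)
open import Data.Bool using (true; false; _∧_; _∨_; not)
open import Data.Bool.Properties using (∧-zeroʳ; ∨-zeroʳ) renaming (_≟_ to _≟ᵇ_)
open import Data.Fin using (Fin; zero; suc)
open import Data.Fin.Patterns using (0F; 1F; 2F; 3F)
open import Data.Fin.Properties using (any?; all?; _≟_)
open import Data.Fin.Subset using (Subset; Side; inside; outside; ∣_∣; _∈_; _⊂_) renaming (⊤ to ⊤ˢ)
open import Data.Fin.Subset.Properties
  using ( ∣p∣≤n; ∣⊤∣≡n; ∈⊤; ⊆⊤; ⊆-antisym; p⊂q⇒∣p∣<∣q∣; x∈p⇒∣p-x∣<∣p∣; x∈p∧x≢y⇒x∈p-y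
        ; _∈?_; anySubset? )
open import Data.Vec using ([]; _∷_; tabulate)
open import Data.Vec.Base using (here; there)
open import Data.Vec.Properties using (lookup∘tabulate; lookup⇒[]=; []=⇒lookup)
open import Data.Unit using (⊤; tt)
open import Data.Product using (Σ; ∃; _×_; _,_; proj₁; proj₂)
open import Data.Sum using (_⊎_; inj₁; inj₂; [_,_])
open import Function using (_∘_; id)
open import Data.Nat.Tactic.RingSolver using (solve-∀)
open import Relation.Nullary using (¬_; Dec; yes; no; does; ⌊_⌋; contradiction)
open import Relation.Nullary.Decidable using (dec-true; decidable-stable; map′; ¬?; _×-dec_; _⊎-dec_; _→-dec_)
open import Relation.Unary using (Pred; Decidable; _⊆_)
open import Relation.Binary.PropositionalEquality using (_≡_; _≢_; refl; sym; trans; subst; cong; cong₂)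
open import Level using (0ℓ)

-- Least elements and stabilising chains

Least : (ℕ → Set) → ℕ → Set
Least P m = P m × (∀ j → P j → m ≤ j)

module _ {P : ℕ → Set} (P? : Decidable P) where

  private
    least-from : ∀ {i} → P i → (∀ j → j < i → ¬ P j) → Least P i
    least-from pᵢ below = pᵢ , λ j pⱼ → ≮⇒≥ (λ j<i → below j j<i pⱼ)

    search : ∀ d i → (∀ j → j < i → ¬ P j) → P (d + i) → ∃ (Least P)
    search zero    i below p = i , least-from p below
    search (suc d) i below p with P? i
    ... | yes pᵢ = i , least-from pᵢ below
    ... | no ¬pᵢ = search d (suc i) below′ (subst P (sym (+-suc d i)) p)
      where
        below′ : ∀ j → j < suc i → ¬ P j
        below′ j j<1+i with m<1+n⇒m<n∨m≡n j<1+i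
        ... | inj₁ j<i  = below j j<i
        ... | inj₂ refl = ¬pᵢ

  least : ∀ {b} → P b → ∃ (Least P)
  least {b} p = search b 0 (λ _ ()) (subst P (sym (+-identityʳ b)) p)

module _ {m : ℕ} {P : Pred (Fin m) 0ℓ} (P? : Decidable P) where

  toSubset : Subset m
  toSubset = tabulate (does ∘ P?)

  ∈-toSubset⁺ : ∀ {v} → P v → v ∈ toSubset
  ∈-toSubset⁺ {v} p = lookup⇒[]= v toSubset (trans (lookup∘tabulate (does ∘ P?) v) (dec-true (P? v) p))

  ∈-toSubset⁻ : ∀ {v} → v ∈ toSubset → P v
  ∈-toSubset⁻ {v} v∈ with P? v | trans (sym (lookup∘tabulate (does ∘ P?) v)) ([]=⇒lookup v∈)
  ... | yes p | _ = p
  ... | no _  | ()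

module Stabilisation {m : ℕ} (P : ℕ → Pred (Fin m) 0ℓ) (P? : ∀ i → Decidable (P i))
    (grow : ∀ i → P i ⊆ P (suc i))
    (settle : ∀ i → P (suc i) ⊆ P i → P (suc (suc i)) ⊆ P (suc i)) where

  Stalls : ℕ → Set
  Stalls i = P (suc i) ⊆ P i

  chain-mono : ∀ {i j} → i ≤ j → P i ⊆ P j
  chain-mono = go ∘ ≤⇒≤′
    where
      go : ∀ {i j} → i ≤′ j → P i ⊆ P j
      go ≤′-refl      = id
      go (≤′-step le) = grow _ ∘ go le

  stalled : ∀ {s j} → Stalls s → s ≤ j → P j ⊆ P s
  stalled {s} st = go ∘ ≤⇒≤′
    where
      stalls : ∀ {j} → s ≤′ j → Stalls j
      stalls ≤′-refl      = st
      stalls (≤′-step le) = settle _ (stalls le)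

      go : ∀ {j} → s ≤′ j → P j ⊆ P s
      go ≤′-refl      = id
      go (≤′-step le) = go le ∘ stalls le

  stalls-or-grows : ∀ i → (∃ λ s → s < i × Stalls s) ⊎ i ≤ ∣ toSubset (P? i) ∣
  stalls-or-grows zero = inj₂ z≤n
  stalls-or-grows (suc i) with stalls-or-grows i
  ... | inj₁ (s , s<i , st) = inj₁ (s , ≤-trans s<i (n≤1+n i) , st)
  ... | inj₂ i≤∣Pᵢ∣ with any? (λ v → P? (suc i) v ×-dec ¬? (P? i v))
  ...   | yes (v , new , ¬old) = inj₂ (≤-trans (s≤s i≤∣Pᵢ∣) (p⊂q⇒∣p∣<∣q∣ strict))
    where
      strict : toSubset (P? i) ⊂ toSubset (P? (suc i))
      strict = (∈-toSubset⁺ (P? (suc i)) ∘ grow i ∘ ∈-toSubset⁻ (P? i)) ,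
               v , ∈-toSubset⁺ (P? (suc i)) new , ¬old ∘ ∈-toSubset⁻ (P? i)
  ...   | no none = inj₁ (i , ≤-refl , λ {v} p → decidable-stable (P? i v) (λ ¬p → none (v , p , ¬p)))

  stable-at-size : ∀ j → P j ⊆ P m
  stable-at-size j with stalls-or-grows (suc m)
  ... | inj₂ 1+m≤ = contradiction (≤-trans 1+m≤ (∣p∣≤n (toSubset (P? (suc m))))) (<-irrefl refl)
  ... | inj₁ (s , s<1+m , st) with ≤-total j s
  ...   | inj₁ j≤s = chain-mono (≤-pred s<1+m) ∘ chain-mono j≤s
  ...   | inj₂ s≤j = chain-mono (≤-pred s<1+m) ∘ stalled st s≤j

-- Deciding the PSD forcing process

module _ {n : ℕ} (G : Adj n) where

  Reach-white : ∀ {B w z} → Reach G B w z → ¬ B z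
  Reach-white (here ¬b)     = ¬b
  Reach-white (step _ _ ¬b) = ¬b

  Reach-antimono : ∀ {B B′ w} → B ⊆ B′ → Reach G B′ w ⊆ Reach G B w
  Reach-antimono B⊆B′ (here ¬b)     = here (¬b ∘ B⊆B′)
  Reach-antimono B⊆B′ (step r e ¬b) = step (Reach-antimono B⊆B′ r) e (¬b ∘ B⊆B′)

  Reach-enclosed : ∀ {B w z} → (∀ v → G w v ≡ true → B v) → Reach G B w z → z ≡ w
  Reach-enclosed N⊆B (here _) = refl
  Reach-enclosed N⊆B (step r e ¬b) with Reach-enclosed N⊆B r
  ... | refl = contradiction (N⊆B _ e) ¬b

  CanForce-resp : ∀ {B B′ u w} → B ⊆ B′ → B′ ⊆ B → CanForce G B u w → CanForce G B′ u w
  CanForce-resp B⊆B′ B′⊆B (bᵤ , ¬bw , uw , only) =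
    B⊆B′ bᵤ , ¬bw ∘ B′⊆B , uw , λ w′ ¬bw′ uw′ r → only w′ (¬bw′ ∘ B⊆B′) uw′ (Reach-antimono B⊆B′ r)

  module _ {B : Pred (Fin n) 0ℓ} (B? : Decidable B) (w : Fin n) where

    ReachWithin : ℕ → Pred (Fin n) 0ℓ
    ReachWithin zero    z = ¬ B w × w ≡ z
    ReachWithin (suc i) z = ReachWithin i z ⊎ ∃ λ v → ReachWithin i v × G v z ≡ true × ¬ B z

    ReachWithin? : ∀ i → Decidable (ReachWithin i)
    ReachWithin? zero    z = ¬? (B? w) ×-dec w ≟ z
    ReachWithin? (suc i) z =
      ReachWithin? i z ⊎-dec any? (λ v → ReachWithin? i v ×-dec G v z ≟ᵇ true ×-dec ¬? (B? z))

    ReachWithin⇒Reach : ∀ {i} → ReachWithin i ⊆ Reach G B w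
    ReachWithin⇒Reach {zero}  (¬b , refl)              = here ¬b
    ReachWithin⇒Reach {suc i} (inj₁ r)                 = ReachWithin⇒Reach r
    ReachWithin⇒Reach {suc i} (inj₂ (_ , r , e , ¬b)) = step (ReachWithin⇒Reach r) e ¬b

    Reach⇒ReachWithin : ∀ {z} → Reach G B w z → ∃ λ i → ReachWithin i z
    Reach⇒ReachWithin (here ¬b) = 0 , ¬b , refl
    Reach⇒ReachWithin (step r e ¬b) with Reach⇒ReachWithin r
    ... | i , r′ = suc i , inj₂ (_ , r′ , e , ¬b)

    private
      settle : ∀ i → ReachWithin (suc i) ⊆ ReachWithin i →
               ReachWithin (suc (suc i)) ⊆ ReachWithin (suc i)
      settle i st (inj₁ r)                 = r
      settle i st (inj₂ (v , r , e , ¬b)) = inj₂ (v , st r , e , ¬b)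

    open Stabilisation ReachWithin ReachWithin? (λ _ → inj₁) settle using (stable-at-size)

    Reach? : Decidable (Reach G B w)
    Reach? z = map′ ReachWithin⇒Reach
      (λ r → let (i , r′) = Reach⇒ReachWithin r in stable-at-size i r′) (ReachWithin? n z)

  CanForce? : ∀ {B} → Decidable B → ∀ u w → Dec (CanForce G B u w)
  CanForce? B? u w = B? u ×-dec ¬? (B? w) ×-dec G u w ≟ᵇ true ×-dec
    all? (λ w′ → ¬? (B? w′) →-dec G u w′ ≟ᵇ true →-dec Reach? B? w w′ →-dec w′ ≟ w)

  Blue? : ∀ S i → Decidable (Blue G S i)
  Blue? S zero    v = v ∈? S
  Blue? S (suc i) v = Blue? S i v ⊎-dec any? (λ u → CanForce? (Blue? S i) u v)

  Blue-settle : ∀ S i → Blue G S (suc i) ⊆ Blue G S i → Blue G S (suc (suc i)) ⊆ Blue G S (suc i)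
  Blue-settle S i st (inj₁ b)       = b
  Blue-settle S i st (inj₂ (u , f)) = inj₂ (u , CanForce-resp st inj₁ f)

  module BlueChain (S : Subset n) = Stabilisation (Blue G S) (Blue? S) (λ _ → inj₁) (Blue-settle S)

  Blue-mono : ∀ {S i j} → i ≤ j → Blue G S i ⊆ Blue G S j
  Blue-mono {S} = BlueChain.chain-mono S

  Blue-step : ∀ {S i v} → (¬ Blue G S i v → ∃ λ u → CanForce G (Blue G S i) u v) → Blue G S (suc i) v
  Blue-step {S} {i} {v} forced with Blue? S i v
  ... | yes b = inj₁ b
  ... | no ¬b = inj₂ (forced ¬b)

  AllBlue? : ∀ S i → Dec (AllBlue G S i)
  AllBlue? S i = all? (Blue? S i)

  IsPSDForcing? : ∀ S → Dec (IsPSDForcing G S)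
  IsPSDForcing? S = map′ (n ,_) (λ (i , all) v → BlueChain.stable-at-size S i (all v)) (AllBlue? S n)

  PT-exists : ∀ {S} → IsPSDForcing G S → ∃ (PT G S)
  PT-exists {S} (_ , all) = least (AllBlue? S) all

  PT-unique : ∀ {S k k′} → PT G S k → PT G S k′ → k ≡ k′
  PT-unique (all , min) (all′ , min′) = ≤-antisym (min _ all′) (min′ _ all)

  CostAttained : ℕ → ℕ → Set
  CostAttained z t = Σ (Subset n) λ S → Σ ℕ λ k → z ≤ ∣ S ∣ × PT G S k × t ≡ ∣ S ∣ * (1 + k)

  CostAttained? : ∀ z t → Dec (CostAttained z t)
  CostAttained? z t = anySubset? attained-by?
    where
      attained-by? : ∀ S → Dec (Σ ℕ λ k → z ≤ ∣ S ∣ × PT G S k × t ≡ ∣ S ∣ * (1 + k))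
      attained-by? S with IsPSDForcing? S
      ... | no ¬f = no λ (k , _ , pt , _) → ¬f (k , proj₁ pt)
      ... | yes f with PT-exists f
      ...   | k , pt = map′ (λ (z≤ , eq) → k , z≤ , pt , eq)
              (λ (k′ , z≤ , pt′ , eq) → z≤ , subst (λ j → t ≡ ∣ S ∣ * (1 + j)) (PT-unique pt′ pt) eq)
              (z ≤? ∣ S ∣ ×-dec t ≟ℕ ∣ S ∣ * (1 + k))

  ThX-exists : ∀ {S₀} → IsPSDForcing G S₀ → ∃ (ThX G)
  ThX-exists {S₀} f₀ with least (λ z → anySubset? (λ S → IsPSDForcing? S ×-dec ∣ S ∣ ≟ℕ z)) (S₀ , f₀ , refl)
  ... | z , forcing-of-size-z , zmin with PT-exists f₀
  ...   | k₀ , pt₀ with least (CostAttained? z) (S₀ , k₀ , zmin _ (S₀ , f₀ , refl) , pt₀ , refl)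
  ...     | t , attained , tmin =
    t , z , (forcing-of-size-z , λ S f → zmin _ (S , f , refl)) , attained ,
    λ S k z≤ pt → tmin _ (S , k , z≤ , pt , refl)

  ThX-≤ : ∀ {t S i} → ThX G t → AllBlue G S i → t ≤ ∣ S ∣ * (1 + i)
  ThX-≤ {S = S} (_ , (_ , zmin) , _ , tmin) all with PT-exists (_ , all)
  ... | k , pt = ≤-trans (tmin S k (zmin S (_ , all)) pt) (*-monoʳ-≤ ∣ S ∣ (s≤s (proj₂ pt _ all)))

-- Subdividing an edge

module Subdivision {n : ℕ} (G : Adj n) (G-sym : ∀ a b → G a b ≡ G b a)
                   (x y : Fin n) (xy∈G : G x y ≡ true) where

  Gₑ : Adj (suc n)
  Gₑ = subdivide G x y

  Endpoint : Pred (Fin n) 0ℓ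
  Endpoint c = c ≡ x ⊎ c ≡ y

  IsE : Fin n → Fin n → Set
  IsE a b = (a ≡ x × b ≡ y) ⊎ (a ≡ y × b ≡ x)

  IsE? : ∀ a b → Dec (IsE a b)
  IsE? a b = (a ≟ x ×-dec b ≟ y) ⊎-dec (a ≟ y ×-dec b ≟ x)

  IsE⇒Endpointˡ : ∀ {a b} → IsE a b → Endpoint a
  IsE⇒Endpointˡ (inj₁ (a≡x , _)) = inj₁ a≡x
  IsE⇒Endpointˡ (inj₂ (a≡y , _)) = inj₂ a≡y

  IsE⇒Endpointʳ : ∀ {a b} → IsE a b → Endpoint b
  IsE⇒Endpointʳ (inj₁ (_ , b≡y)) = inj₂ b≡y
  IsE⇒Endpointʳ (inj₂ (_ , b≡x)) = inj₁ b≡x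

  Endpoint⇒IsE : ∀ {a b} → Endpoint a → Endpoint b → b ≢ a → IsE a b
  Endpoint⇒IsE (inj₁ refl) (inj₁ refl) b≢a = contradiction refl b≢a
  Endpoint⇒IsE (inj₁ refl) (inj₂ refl) _   = inj₁ (refl , refl)
  Endpoint⇒IsE (inj₂ refl) (inj₁ refl) _   = inj₂ (refl , refl)
  Endpoint⇒IsE (inj₂ refl) (inj₂ refl) b≢a = contradiction refl b≢a

  IsE-other : ∀ {a b c} → IsE a b → Endpoint c → c ≢ a → c ≡ b
  IsE-other (inj₁ (refl , refl)) (inj₁ refl) c≢a = contradiction refl c≢a
  IsE-other (inj₁ (refl , refl)) (inj₂ refl) _   = refl
  IsE-other (inj₂ (refl , refl)) (inj₁ refl) _   = refl
  IsE-other (inj₂ (refl , refl)) (inj₂ refl) c≢a = contradiction refl c≢a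

  Endpoint-adjacent : ∀ {c d} → Endpoint c → Endpoint d → d ≡ c ⊎ G c d ≡ true
  Endpoint-adjacent (inj₁ refl) (inj₁ refl) = inj₁ refl
  Endpoint-adjacent (inj₁ refl) (inj₂ refl) = inj₂ xy∈G
  Endpoint-adjacent (inj₂ refl) (inj₁ refl) = inj₂ (trans (G-sym y x) xy∈G)
  Endpoint-adjacent (inj₂ refl) (inj₂ refl) = inj₁ refl

  ⌊≟-refl⌋ : (a : Fin n) → ⌊ a ≟ a ⌋ ≡ true
  ⌊≟-refl⌋ a with a ≟ a
  ... | yes _   = refl
  ... | no a≢a = contradiction refl a≢a

  vₑ-adj⁻ : ∀ b → Gₑ zero (suc b) ≡ true → Endpoint b
  vₑ-adj⁻ b _  with b ≟ x | b ≟ y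
  ... | yes b≡x | _     = inj₁ b≡x
  ... | no _    | yes b≡y = inj₂ b≡y
  vₑ-adj⁻ b () | no _ | no _

  vₑ-adj⁺ : ∀ {b} → Endpoint b → Gₑ zero (suc b) ≡ true
  vₑ-adj⁺ (inj₁ refl) = cong (_∨ ⌊ x ≟ y ⌋) (⌊≟-refl⌋ x)
  vₑ-adj⁺ (inj₂ refl) = trans (cong (⌊ y ≟ x ⌋ ∨_) (⌊≟-refl⌋ y)) (∨-zeroʳ _)

  old-adj⁻ : ∀ {a b} → Gₑ (suc a) (suc b) ≡ true → G a b ≡ true
  old-adj⁻ {a} {b} _ with G a b
  ... | true = refl
  old-adj⁻ () | false

  old-adj⁺ : ∀ {a b} → G a b ≡ true → ¬ IsE a b → Gₑ (suc a) (suc b) ≡ true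
  old-adj⁺ {a} {b} ab∈G ¬e rewrite ab∈G with a ≟ x | b ≟ y | a ≟ y | b ≟ x
  ... | yes a≡x | yes b≡y | _       | _       = contradiction (inj₁ (a≡x , b≡y)) ¬e
  ... | _       | _       | yes a≡y | yes b≡x = contradiction (inj₂ (a≡y , b≡x)) ¬e
  ... | no _    | _       | no _    | _       = refl
  ... | no _    | _       | yes _   | no _    = refl
  ... | yes _   | no _    | no _    | _       = refl
  ... | yes _   | no _    | yes _   | no _    = refl

  e-removed : ∀ {a b} → IsE a b → Gₑ (suc a) (suc b) ≡ false
  e-removed {a} {b} (inj₁ (refl , refl)) with a ≟ a | b ≟ b
  ... | yes _ | yes _ = ∧-zeroʳ _
  ... | no a≢a | _ = contradiction refl a≢a
  ... | _ | no b≢b = contradiction refl b≢b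
  e-removed {a} {b} (inj₂ (refl , refl)) with a ≟ a | b ≟ b
  ... | yes _ | yes _ = trans (cong (λ c → G a b ∧ not c) (∨-zeroʳ _)) (∧-zeroʳ _)
  ... | no a≢a | _ = contradiction refl a≢a
  ... | _ | no b≢b = contradiction refl b≢b

  force-vₑ-enclosed : ∀ {C} → C (suc x) → C (suc y) → ¬ C zero → CanForce Gₑ C (suc x) zero
  force-vₑ-enclosed {C} cx cy ¬cₑ = cx , ¬cₑ , vₑ-adj⁺ (inj₁ refl) , λ _ _ _ → Reach-enclosed Gₑ N⊆C
    where
      N⊆C : ∀ v → Gₑ zero v ≡ true → C v
      N⊆C (suc v) e with vₑ-adj⁻ v e
      ... | inj₁ refl = cx
      ... | inj₂ refl = cy

  force-from-vₑ : ∀ {C a b} → IsE a b → C zero → C (suc a) → ¬ C (suc b) → CanForce Gₑ C zero (suc b)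
  force-from-vₑ {C} {a} {b} e cₑ ca ¬cb = cₑ , ¬cb , vₑ-adj⁺ (IsE⇒Endpointʳ e) , only
    where
      only : ∀ w → ¬ C w → Gₑ zero w ≡ true → Reach Gₑ C (suc b) w → w ≡ suc b
      only (suc w) ¬cw e′ _ = cong suc (IsE-other e (vₑ-adj⁻ w e′) λ { refl → ¬cw ca })

  -- If the blue set C of Gₑ contains the blue set B of G, a white walk in Gₑ maps to a
  -- white walk in G, the passage through vₑ being replaced by the edge e.
  module Projection {C : Pred (Fin (suc n)) 0ℓ} {B : Pred (Fin n) 0ℓ} (B⊆C : B ⊆ C ∘ suc) where

    FromOld : Fin n → Pred (Fin (suc n)) 0ℓ
    FromOld w (suc z) = Reach G B w z
    FromOld w zero    = ∃ λ c → Endpoint c × ¬ C (suc c) × Reach G B w c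

    project : ∀ {w z} → Reach Gₑ C (suc w) z → FromOld w z
    project (here ¬c) = here (¬c ∘ B⊆C)
    project (step {suc _} {suc z} r e ¬c) = step (project r) (old-adj⁻ e) (¬c ∘ B⊆C)
    project (step {suc v} {zero}  r e _)  = v , vₑ-adj⁻ v e , Reach-white Gₑ r , project r
    project (step {zero}  {suc z} r e ¬c) with project r
    ... | c , c-end , _ , r′ with Endpoint-adjacent c-end (vₑ-adj⁻ z e)
    ...   | inj₁ refl = r′
    ...   | inj₂ cz∈G = step r′ cz∈G (¬c ∘ B⊆C)

    FromVₑ : Pred (Fin (suc n)) 0ℓ
    FromVₑ (suc z) = ∃ λ c → Endpoint c × ¬ C (suc c) × Reach G B c z
    FromVₑ zero    = ⊤

    project-vₑ : ∀ {z} → Reach Gₑ C zero z → FromVₑ z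
    project-vₑ (here _) = tt
    project-vₑ (step {suc _} {zero}  r e _)  = tt
    project-vₑ (step {zero}  {suc z} r e ¬c) = z , vₑ-adj⁻ z e , ¬c , here (¬c ∘ B⊆C)
    project-vₑ (step {suc _} {suc z} r e ¬c) with project-vₑ r
    ... | c , c-end , ¬cc , r′ = c , c-end , ¬cc , step r′ (old-adj⁻ e) (¬c ∘ B⊆C)

    force-lift : ∀ {u w} → CanForce G B u w → ¬ IsE u w → ¬ C (suc w) → CanForce Gₑ C (suc u) (suc w)
    force-lift {u} {w} (bᵤ , _ , uw∈G , only) ¬e ¬cw = B⊆C bᵤ , ¬cw , old-adj⁺ uw∈G ¬e , only′
      where
        only′ : ∀ w′ → ¬ C w′ → Gₑ (suc u) w′ ≡ true → Reach Gₑ C (suc w) w′ → w′ ≡ suc w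
        only′ (suc w′) ¬cw′ e r = cong suc (only w′ (¬cw′ ∘ B⊆C) (old-adj⁻ e) (project r))
        only′ zero _ e r with project r
        ... | c , c-end , ¬cc , r′ = contradiction (subst (IsE u) (only c (¬cc ∘ B⊆C) uc∈G r′) uc) ¬e
          where
            c≢u : c ≢ u
            c≢u refl = ¬cc (B⊆C bᵤ)
            uc : IsE u c
            uc = Endpoint⇒IsE (vₑ-adj⁻ u e) c-end c≢u
            uc∈G : G u c ≡ true
            uc∈G with Endpoint-adjacent (vₑ-adj⁻ u e) c-end
            ... | inj₁ c≡u = contradiction c≡u c≢u
            ... | inj₂ uc∈G = uc∈G

    force-into-vₑ : ∀ {a b} → IsE a b → CanForce G B a b → ¬ C zero → CanForce Gₑ C (suc a) zero
    force-into-vₑ {a} {b} e (bₐ , _ , _ , only) ¬cₑ = B⊆C bₐ , ¬cₑ , vₑ-adj⁺ (IsE⇒Endpointˡ e) , only′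
      where
        only′ : ∀ w′ → ¬ C w′ → Gₑ (suc a) w′ ≡ true → Reach Gₑ C zero w′ → w′ ≡ zero
        only′ zero _ _ _ = refl
        only′ (suc w′) ¬cw′ aw′∈Gₑ r with project-vₑ r
        ... | c , c-end , ¬cc , r′ = contradiction (trans (sym (e-removed (subst (IsE a) (sym w′≡b) e))) aw′∈Gₑ) λ ()
          where
            c≡b : c ≡ b
            c≡b = IsE-other e c-end λ { refl → ¬cc (B⊆C bₐ) }
            w′≡b : w′ ≡ b
            w′≡b = only w′ (¬cw′ ∘ B⊆C) (old-adj⁻ aw′∈Gₑ) (subst (λ c → Reach G B c w′) c≡b r′)

  module _ (S : Subset n) (side : Side) where

    private
      B : ℕ → Pred (Fin n) 0ℓ
      B = Blue G S

      C : ℕ → Pred (Fin (suc n)) 0ℓ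
      C = Blue Gₑ (side ∷ S)

    open Projection

    step-with-vₑ : ∀ {i j} → B i ⊆ C j ∘ suc → C j zero → B (suc i) ⊆ C (suc j) ∘ suc
    step-with-vₑ B⊆C cₑ (inj₁ b) = inj₁ (B⊆C b)
    step-with-vₑ {i} {j} B⊆C cₑ {w} (inj₂ (u , f)) = Blue-step Gₑ forced
      where
        forced : ¬ C j (suc w) → ∃ λ v → CanForce Gₑ (C j) v (suc w)
        forced ¬cw with IsE? u w
        ... | no ¬e = suc u , force-lift B⊆C f ¬e ¬cw
        ... | yes e = zero , force-from-vₑ e cₑ (B⊆C (proj₁ f)) ¬cw

    step-without-vₑ : ∀ {i j} → B i ⊆ C j ∘ suc → ∀ {w} → B (suc i) w →
      C (suc j) (suc w) ⊎ (C (suc j) zero × ∃ λ a → IsE a w × B i a)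
    step-without-vₑ B⊆C (inj₁ b) = inj₁ (inj₁ (B⊆C b))
    step-without-vₑ {i} {j} B⊆C {w} (inj₂ (u , f)) with Blue? Gₑ (side ∷ S) j (suc w) | IsE? u w
    ... | yes cw  | _     = inj₁ (inj₁ cw)
    ... | no ¬cw | no ¬e = inj₁ (inj₂ (suc u , force-lift B⊆C f ¬e ¬cw))
    ... | no _    | yes e = inj₂ (Blue-step Gₑ (λ ¬cₑ → suc u , force-into-vₑ B⊆C e f ¬cₑ) , u , e , proj₁ f)

    in-sync : zero ∈ side ∷ S → ∀ i → B i ⊆ C i ∘ suc
    in-sync vₑ∈T zero    = there
    in-sync vₑ∈T (suc i) = step-with-vₑ (in-sync vₑ∈T i) (Blue-mono Gₑ z≤n vₑ∈T)

    -- Gₑ lags at most one round behind G, and not at all at round i unless vₑ is blue by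
    -- round i + 1.
    OneRoundBehind : ℕ → Set
    OneRoundBehind i = B i ⊆ C (suc i) ∘ suc × (C (suc i) zero ⊎ B i ⊆ C i ∘ suc)

    one-round-behind : ∀ i → OneRoundBehind i
    one-round-behind zero = inj₁ ∘ there , inj₂ there
    one-round-behind (suc i) with one-round-behind i
    ... | B⊆C′ , inj₁ cₑ = step-with-vₑ B⊆C′ cₑ , inj₁ (inj₁ cₑ)
    ... | _    , inj₂ B⊆C = behind , caught-up
      where
        behind : B (suc i) ⊆ C (suc (suc i)) ∘ suc
        behind b with step-without-vₑ B⊆C b
        ... | inj₁ cw = inj₁ cw
        ... | inj₂ (cₑ , a , e , bₐ) = Blue-step Gₑ λ ¬cw → zero , force-from-vₑ e cₑ (inj₁ (B⊆C bₐ)) ¬cw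

        caught-up : C (suc (suc i)) zero ⊎ B (suc i) ⊆ C (suc i) ∘ suc
        caught-up with Blue? Gₑ (side ∷ S) (suc i) zero
        ... | yes cₑ = inj₁ (inj₁ cₑ)
        ... | no ¬cₑ = inj₂ λ b → [ id , (λ (cₑ , _) → contradiction cₑ ¬cₑ) ] (step-without-vₑ B⊆C b)

    forcing-with-vₑ : zero ∈ side ∷ S → ∀ {k} → AllBlue G S k → AllBlue Gₑ (side ∷ S) k
    forcing-with-vₑ vₑ∈T all zero    = Blue-mono Gₑ z≤n vₑ∈T
    forcing-with-vₑ vₑ∈T all (suc v) = in-sync vₑ∈T _ (all v)

    forcing-one-round-later : ∀ {k} → AllBlue G S k → AllBlue Gₑ (side ∷ S) (suc k)
    forcing-one-round-later {k} all (suc v) = proj₁ (one-round-behind k) (all v)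
    forcing-one-round-later {k} all zero with proj₂ (one-round-behind k)
    ... | inj₁ cₑ = cₑ
    ... | inj₂ B⊆C = Blue-step Gₑ λ ¬cₑ → suc x , force-vₑ-enclosed (B⊆C (all x)) (B⊆C (all y)) ¬cₑ

subdivision-bound : ∀ {n} (G : Adj n) → (∀ a b → G a b ≡ G b a) → ∀ {x y} → G x y ≡ true →
  ∀ {S k} → AllBlue G S k →
  ∃ λ t → ThX (subdivide G x y) t × t ≤ ∣ S ∣ * (2 + k) × t ≤ (∣ S ∣ + 1) * (1 + k)
subdivision-bound G G-sym {x} {y} xy∈G {S} {k} all =
  t , th , ThX-≤ Gₑ th without-vₑ , subst (λ s → t ≤ s * (1 + k)) (+-comm 1 ∣ S ∣) (ThX-≤ Gₑ th with-vₑ)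
  where
    open Subdivision G G-sym x y xy∈G

    without-vₑ : AllBlue Gₑ (outside ∷ S) (suc k)
    without-vₑ = forcing-one-round-later S outside all

    with-vₑ : AllBlue Gₑ (inside ∷ S) k
    with-vₑ = forcing-with-vₑ S inside here all

    t : ℕ
    t = proj₁ (ThX-exists Gₑ (suc k , without-vₑ))

    th : ThX Gₑ t
    th = proj₂ (ThX-exists Gₑ (suc k , without-vₑ))

-- Lower bounds and the tightness example

two-members : ∀ {m} {S : Subset m} {u v} → u ∈ S → v ∈ S → v ≢ u → 2 ≤ ∣ S ∣
two-members u∈S v∈S v≢u =
  ≤-trans (s≤s (≤-trans (s≤s z≤n) (x∈p⇒∣p-x∣<∣p∣ (x∈p∧x≢y⇒x∈p-y v∈S v≢u)))) (x∈p⇒∣p-x∣<∣p∣ u∈S)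

module _ {n : ℕ} (G : Adj n) where

  Blue-closed : ∀ {S} {Q : Pred (Fin n) 0ℓ} → (∀ {v} → v ∈ S → Q v) →
    (∀ {u w} → Q u → G u w ≡ true → Q w) → ∀ i → Blue G S i ⊆ Q
  Blue-closed S⊆Q closed zero                             = S⊆Q
  Blue-closed S⊆Q closed (suc i) (inj₁ b)                  = Blue-closed S⊆Q closed i b
  Blue-closed S⊆Q closed (suc i) (inj₂ (_ , bᵤ , _ , uw , _)) = closed (Blue-closed S⊆Q closed i bᵤ) uw

  forcing-meets : ∀ {S i v} {Q : Pred (Fin n) 0ℓ} → (∀ {u w} → G u w ≡ true → Q w → Q u) →
    Q v → AllBlue G S i → ∃ λ u → u ∈ S × Q u
  forcing-meets {S} {i} {v} {Q} closed qv all =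
    Blue-closed {Q = λ w → Q w → ∃ λ u → u ∈ S × Q u} (λ u∈S qu → _ , u∈S , qu)
      (λ meets uw qw → meets (closed uw qw)) i (all v) qv

  AllBlue-zero : ∀ {S} → AllBlue G S 0 → ∣ S ∣ ≡ n
  AllBlue-zero {S} all = trans (cong ∣_∣ (⊆-antisym ⊆⊤ (λ {v} _ → all v))) (∣⊤∣≡n n)

  order≤cost : ∀ {S k} → n ≤ 2 * ∣ S ∣ → AllBlue G S k → n ≤ ∣ S ∣ * (1 + k)
  order≤cost {S} {zero}  _    all = ≤-reflexive (sym (trans (*-identityʳ ∣ S ∣) (AllBlue-zero all)))
  order≤cost {S} {suc k} n≤2s _   =
    ≤-trans n≤2s (subst (_≤ ∣ S ∣ * (2 + k)) (*-comm ∣ S ∣ 2) (*-monoʳ-≤ ∣ S ∣ (s≤s (s≤s z≤n))))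

  PT-⊤ : PT G ⊤ˢ 0
  PT-⊤ = (λ _ → ∈⊤) , λ _ _ → z≤n

  ThX-order : ∀ {z} → ZPlus G z → n ≤ 2 * z → ThX G n
  ThX-order {z} Zz@((S₀ , _ , ∣S₀∣≡z) , _) n≤2z =
    z , Zz , (⊤ˢ , 0 , z≤∣⊤∣ , PT-⊤ , sym ∣⊤∣*1≡n) ,
    λ S k z≤∣S∣ pt → order≤cost (≤-trans n≤2z (*-monoʳ-≤ 2 z≤∣S∣)) (proj₁ pt)
    where
      z≤∣⊤∣ : z ≤ ∣ ⊤ˢ {n} ∣
      z≤∣⊤∣ = subst (z ≤_) (sym (∣⊤∣≡n n)) (subst (_≤ n) ∣S₀∣≡z (∣p∣≤n S₀))

      ∣⊤∣*1≡n : ∣ ⊤ˢ {n} ∣ * 1 ≡ n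
      ∣⊤∣*1≡n = trans (*-identityʳ _) (∣⊤∣≡n n)

K₂+K₁ : Adj 3
K₂+K₁ 0F 1F = true
K₂+K₁ 1F 0F = true
K₂+K₁ _  _  = false

K₂+K₁-simple : IsSimple K₂+K₁
K₂+K₁-simple = symmetric , λ { 0F → refl ; 1F → refl ; 2F → refl }
  where
    symmetric : ∀ a b → K₂+K₁ a b ≡ K₂+K₁ b a
    symmetric 0F 0F = refl
    symmetric 0F 1F = refl
    symmetric 0F 2F = refl
    symmetric 1F 0F = refl
    symmetric 1F 1F = refl
    symmetric 1F 2F = refl
    symmetric 2F 0F = refl
    symmetric 2F 1F = refl
    symmetric 2F 2F = refl

Z₊-K₂+K₁ : ZPlus K₂+K₁ 2
Z₊-K₂+K₁ = (inside ∷ outside ∷ inside ∷ [] , (1 , forcing) , refl) , at-least-2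
  where
    forcing : AllBlue K₂+K₁ (inside ∷ outside ∷ inside ∷ []) 1
    forcing 0F = inj₁ here
    forcing 1F = inj₂ (0F , here , (λ { (there ()) }) , refl , λ { 1F _ _ _ → refl })
    forcing 2F = inj₁ (there (there here))

    at-least-2 : ∀ S → IsPSDForcing K₂+K₁ S → 2 ≤ ∣ S ∣
    at-least-2 S (i , all)
      with forcing-meets K₂+K₁ {Q = _≡ 2F} (λ { {2F} _ refl → refl }) refl all
         | forcing-meets K₂+K₁ {v = 0F} {Q = _≢ 2F} (λ { {2F} () }) (λ ()) all
    ... | _ , 2F∈S , refl | _ , u∈S , u≢2F = two-members 2F∈S u∈S u≢2F

P₃+K₁ : Adj 4
P₃+K₁ = subdivide K₂+K₁ 0F 1F

Z₊-P₃+K₁ : ZPlus P₃+K₁ 2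
Z₊-P₃+K₁ = (inside ∷ outside ∷ outside ∷ inside ∷ [] , (1 , forcing) , refl) , at-least-2
  where
    forcing : AllBlue P₃+K₁ (inside ∷ outside ∷ outside ∷ inside ∷ []) 1
    forcing 0F = inj₁ here
    forcing 1F = inj₂ (0F , here , (λ { (there ()) }) , refl , only)
      where
        only : ∀ w → ¬ Blue P₃+K₁ _ 0 w → P₃+K₁ 0F w ≡ true → Reach P₃+K₁ (Blue P₃+K₁ _ 0) 1F w → w ≡ 1F
        only 0F ¬b _ _ = contradiction here ¬b
        only 1F _  _ _ = refl
        only 2F _  _ r = contradiction (Reach-enclosed P₃+K₁ (λ { 0F _ → here ; 1F () ; 2F () ; 3F () }) r) λ ()
    forcing 2F = inj₂ (0F , here , (λ { (there (there ())) }) , refl , only)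
      where
        only : ∀ w → ¬ Blue P₃+K₁ _ 0 w → P₃+K₁ 0F w ≡ true → Reach P₃+K₁ (Blue P₃+K₁ _ 0) 2F w → w ≡ 2F
        only 0F ¬b _ _ = contradiction here ¬b
        only 1F _  _ r = contradiction (Reach-enclosed P₃+K₁ (λ { 0F _ → here ; 1F () ; 2F () ; 3F () }) r) λ ()
        only 2F _  _ _ = refl
    forcing 3F = inj₁ (there (there (there here)))

    at-least-2 : ∀ S → IsPSDForcing P₃+K₁ S → 2 ≤ ∣ S ∣
    at-least-2 S (i , all)
      with forcing-meets P₃+K₁ {Q = _≡ 3F} (λ { {3F} _ refl → refl }) refl all
         | forcing-meets P₃+K₁ {v = 0F} {Q = _≢ 3F} (λ { {3F} {0F} () ; {3F} {suc _} () }) (λ ()) all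
    ... | _ , 3F∈S , refl | _ , u∈S , u≢3F = two-members 3F∈S u∈S u≢3F

extra-round : ∀ s k → s * (2 + k) ≡ s * (1 + k) + s
extra-round = solve-∀

extra-vertex : ∀ s k → (s + 1) * (1 + k) ≡ s * (1 + k) + k + 1
extra-vertex = solve-∀

mainTheorem7 :
  -- the bound
  ((n : ℕ) (G : Adj n) → IsSimple G → (x y : Fin n) → G x y ≡ true →
    (S : Subset n) (k : ℕ) → PT G S k → ThX G (∣ S ∣ * (1 + k)) →
    Σ ℕ λ t → ThX (subdivide G x y) t
      × t ≤ (∣ S ∣ * (2 + k)) ⊓ ((∣ S ∣ + 1) * (1 + k))
      × (∣ S ∣ * (2 + k)) ⊓ ((∣ S ∣ + 1) * (1 + k))
          ≡ (∣ S ∣ * (1 + k) + ∣ S ∣) ⊓ (∣ S ∣ * (1 + k) + k + 1))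
  ×
  -- tightness: the bound is attained for some graph, edge and set S
  (Σ ℕ λ n → Σ (Adj n) λ G → IsSimple G × Σ (Fin n) λ x → Σ (Fin n) λ y →
    G x y ≡ true × Σ (Subset n) λ S → Σ ℕ λ k →
    PT G S k × ThX G (∣ S ∣ * (1 + k)) ×
    ThX (subdivide G x y) ((∣ S ∣ * (2 + k)) ⊓ ((∣ S ∣ + 1) * (1 + k))))
mainTheorem7 =
  (λ n G (G-sym , _) x y xy∈G S k (all , _) _ →
    let (t , th , t≤₁ , t≤₂) = subdivision-bound G G-sym xy∈G all
    in t , th , ⊓-glb t≤₁ t≤₂ , cong₂ _⊓_ (extra-round ∣ S ∣ k) (extra-vertex ∣ S ∣ k)) ,
  (3 , K₂+K₁ , K₂+K₁-simple , 0F , 1F , refl , ⊤ˢ , 0 , PT-⊤ K₂+K₁ ,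
   ThX-order K₂+K₁ Z₊-K₂+K₁ (s≤s (s≤s (s≤s z≤n))) , ThX-order P₃+K₁ Z₊-P₃+K₁ ≤-refl)
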